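{- Let $G$ be a finite simple graph with $|G|$ vertices and maximum degree $\Delta(G)$. If $\frac{2}{3}|G|-1>\Delta(G)\geq \frac{2}{3}|G|-2$, then $a_{eq}(G)\leq \left\lceil\frac{\Delta(G)+1}{2}\right\rceil$.
   Context: All graphs are finite, undirected, without loops or multiple edges; $|G|$ denotes the number of vertices of $G$. A graph $G$ admits an equitable $k$-tree-coloring if $V(G)$ can be partitioned into $k$ subsets, each of size $\lceil |G|/k\rceil$ or $\lfloor |G|/k\rfloor$, such that each subset induces a forest in $G$. The equitable vertex arboricity $a_{eq}(G)$ is the minimum integer $k$ such that $G$ has an equitable $k$-tree-coloring. -}

module Defs where

open import Data.Nat using (ℕ; zero; suc; _+_; _*_; _∸_; _≤_; _<_; _⊔_; NonZero)
open import Data.Nat.DivMod using (_/_)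
open import Data.Fin using (Fin; zero; suc; inject₁; fromℕ; _≟_)
open import Data.Fin.Properties using ()
open import Data.Bool using (Bool; true; false; T; T?)
open import Data.List using (List; length; filter; map; foldr; allFin)
open import Data.Product using (Σ; ∃; _×_; _,_)
open import Data.Sum using (_⊎_)
open import Relation.Binary.PropositionalEquality using (_≡_)
open import Relation.Nullary using (¬_)
open import Relation.Nullary.Decidable using (does)
open import Function.Definitions using (Injective)

record Graph (n : ℕ) : Set where
  field
    adj     : Fin n → Fin n → Bool
    adj-sym : ∀ u v → adj u v ≡ adj v u
    irrefl  : ∀ v → adj v v ≡ false
open Graph public

order : ∀ {n} → Graph n → ℕ
order {n} _ = n

degree : ∀ {n} → Graph n → Fin n → ℕ
degree {n} G v = length (filter (λ u → T? (adj G v u)) (allFin n))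

maxDegree : ∀ {n} → Graph n → ℕ
maxDegree {n} G = foldr _⊔_ 0 (map (degree G) (allFin n))

record Cycle {n : ℕ} (G : Graph n) : Set where
  field
    len    : ℕ     -- the cycle has len + 3 vertices
    vtx    : Fin (suc (suc (suc len))) → Fin n
    inj    : Injective _≡_ _≡_ vtx
    step   : ∀ (i : Fin (suc (suc len))) → adj G (vtx (inject₁ i)) (vtx (suc i)) ≡ true
    close  : adj G (vtx (fromℕ (suc (suc len)))) (vtx zero) ≡ true
open Cycle public

InducesForest : ∀ {n} → Graph n → (Fin n → Set) → Set
InducesForest G P = ¬ (Σ (Cycle G) λ C → ∀ i → P (vtx C i))

classSize : ∀ {n k} → (Fin n → Fin k) → Fin k → ℕ
classSize {n} c i = length (filter (λ v → c v ≟ i) (allFin n))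

ceilDiv : (n k : ℕ) → .{{NonZero k}} → ℕ
ceilDiv n k = (n + k ∸ 1) / k

EquitableTreeColoring : ∀ {n} → Graph n → (k : ℕ) → .{{NonZero k}} → Set
EquitableTreeColoring {n} G k =
  Σ (Fin n → Fin k) λ c →
    ∀ (i : Fin k) →
      (classSize c i ≡ n / k ⊎ classSize c i ≡ ceilDiv n k)
      × InducesForest G (λ v → c v ≡ i)

-- a_eq(G) ≤ m : some k = suc j with 1 ≤ k ≤ m admits an equitable k-tree-coloring
-- (a_eq(G) is the least such k, so this is exactly "a_eq(G) ≤ m").
AeqAtMost : ∀ {n} → Graph n → ℕ → Set
AeqAtMost G m = Σ ℕ λ j → (suc j ≤ m) × EquitableTreeColoring G (suc j)

module Submission where

open import Defs
open import Data.Nat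
  using (ℕ; zero; suc; _+_; _*_; _∸_; _≤_; _<_; _⊔_; NonZero; ⌊_/2⌋; ⌈_/2⌉; s≤s; s≤s⁻¹; z≤n)
open import Data.Nat.Properties
  using ( +-comm; +-suc; *-comm; suc-injective; n≤1+n; n<1+n; m≤n+m; m≤m⊔n; m≤n⊔m
        ; ≤-refl; ≤-reflexive; ≤-trans; ≤-antisym; ≤-<-trans; <-≤-trans; <⇒≱; m≤n⇒m<n∨m≡n
        ; +-mono-≤; +-monoˡ-≤; +-monoʳ-≤; +-mono-<; +-mono-<-≤; +-mono-≤-<; *-monoʳ-≤
        ; +-cancelˡ-≤; +-cancelʳ-≤; +-cancelʳ-≡; *-cancelˡ-≤; *-cancelˡ-<
        ; ⌊n/2⌋-mono; ⌊n/2⌋≤⌈n/2⌉; ⌊n/2⌋+⌈n/2⌉≡n; module ≤-Reasoning )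
open import Data.Nat.DivMod using (_/_; m*n/n≡m; m<n*o⇒m/o<n; /-monoˡ-≤)
open import Data.Nat.Tactic.RingSolver using (solve-∀)
open import Data.Fin using (Fin; zero; suc; inject₁; fromℕ; _≟_)
import Data.Fin.Properties as Fin
open import Data.Fin.Relation.Unary.Top using (view; ‵fromℕ; ‵inj₁)
open import Data.Bool using (T; T?; true; false)
open import Data.Empty using (⊥; ⊥-elim)
open import Data.Product using (Σ; ∃; ∃₂; _,_; _×_; proj₁; proj₂; uncurry)
open import Data.Sum using (_⊎_; inj₁; inj₂; [_,_]′)
open import Data.List using (List; []; _∷_; _++_; length; filter; concat; lookup; allFin; foldr; map)
open import Data.List.Properties
  using (length-++; length-filter; length-tabulate; filter-++; filter-all; filter-none; ++-identityʳ)
open import Data.List.Membership.Propositional using (_∈_; _∉_; find; lose)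
open import Data.List.Membership.Propositional.Properties
  using (∈-∃++; ∈-++⁺ʳ; ∈-concat⁺′; ∈-concat⁻; ∈-lookup; ∈-allFin)
open import Data.List.Relation.Unary.All as All using (All; []; _∷_)
open import Data.List.Relation.Unary.All.Properties using (¬Any⇒All¬)
open import Data.List.Relation.Unary.Any as Any using (Any; here; there; any?)
open import Data.List.Relation.Unary.Any.Properties using (lookup-index)
open import Data.List.Relation.Unary.Unique.Propositional using (Unique; _∷_)
open import Data.List.Relation.Unary.Unique.Propositional.Properties using (allFin⁺)
open import Data.List.Relation.Binary.Permutation.Propositional
  using (_↭_; ↭-refl; ↭-sym; ↭-trans; ↭-prep; ↭-swap; ↭⇒↭ₛ; module PermutationReasoning)
import Data.List.Relation.Binary.Permutation.Propositional as ↭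
open import Data.List.Relation.Binary.Permutation.Propositional.Properties
  using (∈-resp-↭; All-resp-↭; ↭-length; shift; shifts; ++⁺ˡ; ++⁺ʳ; filter-↭)
import Data.List.Relation.Binary.Permutation.Setoid.Properties as PermutationSetoid
open import Function using (_∘_)
open import Function.Bundles using (_⇔_; mk⇔; Equivalence)
open import Level using (0ℓ)
open import Relation.Binary using (Rel; Symmetric)
import Relation.Binary as Binary
open import Relation.Binary.PropositionalEquality
  using (_≡_; _≢_; refl; sym; trans; cong; cong₂; subst; setoid; module ≡-Reasoning)
open import Relation.Nullary using (¬_; yes; no)
open import Relation.Nullary.Decidable using (does; ¬?; _×-dec_; _⊎-dec_)
open import Relation.Unary using (Pred; Decidable)

-- Let Δ = Δ(G) and k = ⌈(Δ+1)/2⌉ = ⌊Δ/2⌋ + 1.  The hypotheses say Δ ≤ 2k − 1 and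
-- 3k − 1 ≤ |G| ≤ 3k + 1.  Every vertex then has more than |G| − 2k non-neighbours
-- (counting itself), so the augmenting-path argument gives a matching M of size
-- s = |G| − 2k in the complement of G, leaving |G| − 2s unmatched vertices.  A pair of
-- M together with one unmatched vertex induces a forest in G.  If |G| = 3k − 1 the two
-- remaining unmatched vertices form one more class.  If |G| = 3k + 1, a vertex a of a
-- pair ab of M has a non-neighbour x in another pair xy of M (otherwise it has too few
-- non-neighbours), and G restricted to {a, b, x, y} is a subgraph of a path.  The k
-- classes have sizes q or q + 1 for a single q, hence form an equitable tree-colouring.

-- Lists, permutations and blocks

length-allFin : ∀ n → length (allFin n) ≡ n
length-allFin n = length-tabulate (λ i → i)

module _ {A : Set} where

  ∈-∃↭ : ∀ {x : A} {xs} → x ∈ xs → ∃ λ ys → xs ↭ x ∷ ys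
  ∈-∃↭ x∈xs with ∈-∃++ x∈xs
  ... | ys , zs , refl = ys ++ zs , shift _ ys zs

  Unique-resp-↭ : ∀ {xs ys : List A} → xs ↭ ys → Unique xs → Unique ys
  Unique-resp-↭ p = PermutationSetoid.Unique-resp-↭ (setoid A) (↭⇒↭ₛ p)

  Unique-++⇒∉ : ∀ {x} xs {ys : List A} → Unique (xs ++ ys) → x ∈ xs → x ∉ ys
  Unique-++⇒∉ (_ ∷ xs) (x≢ ∷ _) (here refl)  x∈ys = All.lookup x≢ (∈-++⁺ʳ xs x∈ys) refl
  Unique-++⇒∉ (_ ∷ xs) (_ ∷ u)  (there x∈xs)      = Unique-++⇒∉ xs u x∈xs

  Unique-++⁻ʳ : ∀ xs {ys : List A} → Unique (xs ++ ys) → Unique ys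
  Unique-++⁻ʳ []       u       = u
  Unique-++⁻ʳ (_ ∷ xs) (_ ∷ u) = Unique-++⁻ʳ xs u

  lookup-concat-unique : ∀ (bs : List (List A)) {x i j} → Unique (concat bs) →
                         x ∈ lookup bs i → x ∈ lookup bs j → i ≡ j
  lookup-concat-unique (B ∷ bs) {i = zero}  {zero}  u x∈ x∈′ = refl
  lookup-concat-unique (B ∷ bs) {i = zero}  {suc j} u x∈ x∈′ =
    ⊥-elim (Unique-++⇒∉ B u x∈ (∈-concat⁺′ x∈′ (∈-lookup {xs = bs} j)))
  lookup-concat-unique (B ∷ bs) {i = suc i} {zero}  u x∈ x∈′ =
    ⊥-elim (Unique-++⇒∉ B u x∈′ (∈-concat⁺′ x∈ (∈-lookup {xs = bs} i)))
  lookup-concat-unique (B ∷ bs) {i = suc i} {suc j} u x∈ x∈′ =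
    cong suc (lookup-concat-unique bs (Unique-++⁻ʳ B u) x∈ x∈′)

  filter-concat≡lookup : ∀ {P : Pred A 0ℓ} (P? : Decidable P) (bs : List (List A)) i →
                         (∀ j {x} → x ∈ lookup bs j → P x ⇔ j ≡ i) → filter P? (concat bs) ≡ lookup bs i
  filter-concat≡lookup {P} P? (B ∷ bs) zero block = begin
    filter P? (B ++ concat bs)            ≡⟨ filter-++ P? B (concat bs) ⟩
    filter P? B ++ filter P? (concat bs)  ≡⟨ cong₂ _++_ (filter-all P? in-B) (filter-none P? not-in-rest) ⟩
    B ++ []                               ≡⟨ ++-identityʳ B ⟩
    B                                     ∎
    where
    open ≡-Reasoning
    in-B : All P B
    in-B = All.tabulate λ x∈ → Equivalence.from (block zero x∈) refl
    not-in-rest : All (¬_ ∘ P) (concat bs)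
    not-in-rest = All.tabulate λ x∈ Px → let a = ∈-concat⁻ bs x∈ in
      Fin.0≢1+n (sym (Equivalence.to (block (suc (Any.index a)) (lookup-index a)) Px))
  filter-concat≡lookup {P} P? (B ∷ bs) (suc i) block = begin
    filter P? (B ++ concat bs)            ≡⟨ filter-++ P? B (concat bs) ⟩
    filter P? B ++ filter P? (concat bs)  ≡⟨ cong₂ _++_ (filter-none P? not-in-B)
                                                       (filter-concat≡lookup P? bs i block′) ⟩
    lookup bs i                           ∎
    where
    open ≡-Reasoning
    not-in-B : All (¬_ ∘ P) B
    not-in-B = All.tabulate λ x∈ Px → Fin.0≢1+n (Equivalence.to (block zero x∈) Px)
    block′ : ∀ j {x} → x ∈ lookup bs j → P x ⇔ j ≡ i
    block′ j x∈ = mk⇔ (Fin.suc-injective ∘ Equivalence.to (block (suc j) x∈))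
                      (Equivalence.from (block (suc j) x∈) ∘ cong suc)

  length-filter-∁ : ∀ {P : Pred A 0ℓ} (P? : Decidable P) xs →
                    length (filter P? xs) + length (filter (¬? ∘ P?) xs) ≡ length xs
  length-filter-∁ P? []       = refl
  length-filter-∁ P? (x ∷ xs) with does (P? x)
  ... | true  = cong suc (length-filter-∁ P? xs)
  ... | false = trans (+-suc _ _) (cong suc (length-filter-∁ P? xs))

  ≤-foldr-⊔ : ∀ (f : A → ℕ) {x xs} → x ∈ xs → f x ≤ foldr _⊔_ 0 (map f xs)
  ≤-foldr-⊔ f {xs = y ∷ _} (here refl) = m≤m⊔n (f y) _
  ≤-foldr-⊔ f {xs = y ∷ _} (there x∈)  = ≤-trans (≤-foldr-⊔ f x∈) (m≤n⊔m (f y) _)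

  length-concat-≤ : ∀ {c} (bs : List (List A)) → All (λ B → length B ≤ c) bs →
                    length (concat bs) ≤ length bs * c
  length-concat-≤ []       []       = z≤n
  length-concat-≤ (B ∷ bs) (h ∷ hs) =
    ≤-trans (≤-reflexive (length-++ B)) (+-mono-≤ h (length-concat-≤ bs hs))

  length-concat-≥ : ∀ {c} (bs : List (List A)) → All (λ B → c ≤ length B) bs →
                    length bs * c ≤ length (concat bs)
  length-concat-≥ []       []       = z≤n
  length-concat-≥ (B ∷ bs) (h ∷ hs) =
    ≤-trans (+-mono-≤ h (length-concat-≥ bs hs)) (≤-reflexive (sym (length-++ B)))

  length-concat-< : ∀ {c} (bs : List (List A)) → All (λ B → length B ≤ c) bs →
                    Any (λ B → length B < c) bs → length (concat bs) < length bs * c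
  length-concat-< (B ∷ bs) (h ∷ hs) (here lt) =
    ≤-<-trans (≤-reflexive (length-++ B)) (+-mono-<-≤ lt (length-concat-≤ bs hs))
  length-concat-< (B ∷ bs) (h ∷ hs) (there a) =
    ≤-<-trans (≤-reflexive (length-++ B)) (+-mono-≤-< h (length-concat-< bs hs a))

  length-concat-> : ∀ {c} (bs : List (List A)) → All (λ B → c ≤ length B) bs →
                    Any (λ B → c < length B) bs → length bs * c < length (concat bs)
  length-concat-> (B ∷ bs) (h ∷ hs) (here lt) =
    <-≤-trans (+-mono-<-≤ lt (length-concat-≥ bs hs)) (≤-reflexive (sym (length-++ B)))
  length-concat-> (B ∷ bs) (h ∷ hs) (there a) =
    <-≤-trans (+-mono-≤-< h (length-concat-> bs hs a)) (≤-reflexive (sym (length-++ B)))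

/-between : ∀ {n k q} .{{_ : NonZero k}} → k * q ≤ n → n < k * suc q → n / k ≡ q
/-between {n} {k} {q} lower upper = ≤-antisym
  (s≤s⁻¹ (m<n*o⇒m/o<n (subst (n <_) (*-comm k (suc q)) upper)))
  (subst (_≤ n / k) (m*n/n≡m q k) (/-monoˡ-≤ k (subst (_≤ n) (*-comm k q) lower)))

ceilDiv-between : ∀ {n k q} .{{_ : NonZero k}} → k * q < n → n ≤ k * suc q → ceilDiv n k ≡ suc q
ceilDiv-between {n} {suc j} {q} lower upper = begin
  (n + suc j ∸ 1) / suc j  ≡⟨ cong (λ m → (m ∸ 1) / suc j) (+-suc n j) ⟩
  (n + j) / suc j          ≡⟨ /-between lower′ upper′ ⟩
  suc q                    ∎
  where
  open ≡-Reasoning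
  shift-j : ∀ j q → suc (suc j * q) + j ≡ suc j * suc q
  shift-j = solve-∀
  lower′ : suc j * suc q ≤ n + j
  lower′ = subst (_≤ n + j) (shift-j j q) (+-monoˡ-≤ j lower)
  upper′ : n + j < suc j * suc (suc q)
  upper′ = subst (n + j <_) (shift-j j (suc q)) (s≤s (+-monoˡ-≤ j upper))

balanced⇒equitable : ∀ {A : Set} {q} (bs : List (List A)) .{{_ : NonZero (length bs)}} →
  All (λ B → length B ≡ q ⊎ length B ≡ suc q) bs →
  All (λ B → length B ≡ length (concat bs) / length bs ⊎ length B ≡ ceilDiv (length (concat bs)) (length bs)) bs
balanced⇒equitable {A} {q} bs sizes = All.tabulate λ B∈ → [ small B∈ , large B∈ ]′ (All.lookup sizes B∈)
  where
  Equitable : List A → Set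
  Equitable B = length B ≡ length (concat bs) / length bs ⊎ length B ≡ ceilDiv (length (concat bs)) (length bs)
  lower : All (λ B → q ≤ length B) bs
  lower = All.map [ ≤-reflexive ∘ sym , (λ e → ≤-trans (n≤1+n q) (≤-reflexive (sym e))) ]′ sizes
  upper : All (λ B → length B ≤ suc q) bs
  upper = All.map [ (λ e → ≤-trans (≤-reflexive e) (n≤1+n q)) , ≤-reflexive ]′ sizes
  small : ∀ {B} → B ∈ bs → length B ≡ q → Equitable B
  small B∈ e = inj₁ (trans e (sym (/-between (length-concat-≥ bs lower)
                 (length-concat-< bs upper (lose B∈ (s≤s (≤-reflexive e)))))))
  large : ∀ {B} → B ∈ bs → length B ≡ suc q → Equitable B
  large B∈ e = inj₂ (trans e (sym (ceilDiv-between (length-concat-> bs lower (lose B∈ (≤-reflexive (sym e))))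
                 (length-concat-≤ bs upper))))

-- Arithmetic of the hypotheses

≤-≤-2+-cases : ∀ {a n} → a ≤ n → n ≤ 2 + a → n ≡ a ⊎ n ≡ suc a ⊎ n ≡ suc (suc a)
≤-≤-2+-cases a≤n n≤2+a with m≤n⇒m<n∨m≡n a≤n
... | inj₂ a≡n = inj₁ (sym a≡n)
... | inj₁ a<n with m≤n⇒m<n∨m≡n a<n
...   | inj₂ 1+a≡n  = inj₂ (inj₁ (sym 1+a≡n))
...   | inj₁ 1+a<n  = inj₂ (inj₂ (≤-antisym n≤2+a 1+a<n))

half-bounds : ∀ d → ⌊ d /2⌋ + ⌊ d /2⌋ ≤ d × d ≤ suc (⌊ d /2⌋ + ⌊ d /2⌋)
half-bounds d = ≤-trans (+-monoʳ-≤ m (⌊n/2⌋≤⌈n/2⌉ d)) (≤-reflexive (⌊n/2⌋+⌈n/2⌉≡n d))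
              , ≤-trans (≤-reflexive (sym (⌊n/2⌋+⌈n/2⌉≡n d)))
                        (≤-trans (+-monoʳ-≤ m (⌊n/2⌋-mono (n≤1+n (suc d)))) (≤-reflexive (+-suc m m)))
  where
  m : ℕ
  m = ⌊ d /2⌋

order-bounds : ∀ {d n} → 3 * d + 3 < 2 * n → 2 * n ≤ 3 * d + 6 →
               3 * ⌊ d /2⌋ + 2 ≤ n × n ≤ 3 * ⌊ d /2⌋ + 4
order-bounds {d} {n} lower upper = *-cancelˡ-≤ 2 (begin
    2 * (3 * m + 2)            ≡⟨ lower-identity m ⟩
    3 * (m + m) + 4            ≤⟨ +-monoˡ-≤ 4 (*-monoʳ-≤ 3 (proj₁ (half-bounds d))) ⟩
    3 * d + 4                  ≡⟨ +-suc (3 * d) 3 ⟩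
    suc (3 * d + 3)            ≤⟨ lower ⟩
    2 * n                      ∎)
  , s≤s⁻¹ (*-cancelˡ-< 2 n (suc (3 * m + 4)) (begin-strict
    2 * n                      ≤⟨ upper ⟩
    3 * d + 6                  ≤⟨ +-monoˡ-≤ 6 (*-monoʳ-≤ 3 (proj₂ (half-bounds d))) ⟩
    3 * suc (m + m) + 6        <⟨ n<1+n _ ⟩
    suc (3 * suc (m + m) + 6)  ≡⟨ upper-identity m ⟩
    2 * suc (3 * m + 4)        ∎))
  where
  open ≤-Reasoning
  m : ℕ
  m = ⌊ d /2⌋
  lower-identity : ∀ m → 2 * (3 * m + 2) ≡ 3 * (m + m) + 4
  lower-identity = solve-∀
  upper-identity : ∀ m → suc (3 * suc (m + m) + 6) ≡ 2 * suc (3 * m + 4)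
  upper-identity = solve-∀

endpoints : ∀ {A : Set} → List (A × A) → List A
endpoints []             = []
endpoints ((x , y) ∷ es) = x ∷ y ∷ endpoints es

triples : ∀ {A : Set} → List (A × A) → List A → List (List A)
triples ((a , b) ∷ es) (c ∷ cs) = (a ∷ b ∷ c ∷ []) ∷ triples es cs
triples _              _        = []

module _ {A : Set} where

  endpoints-↭ : ∀ {es es′ : List (A × A)} → es ↭ es′ → endpoints es ↭ endpoints es′
  endpoints-↭ ↭.refl                     = ↭-refl
  endpoints-↭ (↭.prep (a , b) p)         = ↭-prep a (↭-prep b (endpoints-↭ p))
  endpoints-↭ (↭.swap (a , b) (c , d) p) =
    ↭-trans (shifts (a ∷ b ∷ []) (c ∷ d ∷ [])) (++⁺ˡ (c ∷ d ∷ a ∷ b ∷ []) (endpoints-↭ p))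
  endpoints-↭ (↭.trans p q)              = ↭-trans (endpoints-↭ p) (endpoints-↭ q)

  length-endpoints : ∀ (es : List (A × A)) → length (endpoints es) ≡ length es + length es
  length-endpoints []             = refl
  length-endpoints ((x , y) ∷ es) = cong suc (trans (cong suc (length-endpoints es)) (sym (+-suc _ _)))

  length-triples : ∀ (es : List (A × A)) cs → length es ≡ length cs → length (triples es cs) ≡ length es
  length-triples []             []       _ = refl
  length-triples ((a , b) ∷ es) (c ∷ cs) e = cong suc (length-triples es cs (suc-injective e))

  concat-triples : ∀ (es : List (A × A)) cs → length es ≡ length cs →
                   concat (triples es cs) ↭ endpoints es ++ cs
  concat-triples []             []       _ = ↭-refl
  concat-triples ((a , b) ∷ es) (c ∷ cs) e = ++⁺ˡ (a ∷ b ∷ []) (↭-trans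
    (↭-prep c (concat-triples es cs (suc-injective e))) (↭-sym (shift c (endpoints es) cs)))

  triples-length : ∀ (es : List (A × A)) cs → All (λ B → length B ≡ 3) (triples es cs)
  triples-length []             _        = []
  triples-length ((a , b) ∷ es) []       = []
  triples-length ((a , b) ∷ es) (c ∷ cs) = refl ∷ triples-length es cs

  All-triples : ∀ {R : A → A → Set} {P : List A → Set} → (∀ {a b} c → R a b → P (a ∷ b ∷ c ∷ [])) →
                ∀ {es} cs → All (uncurry R) es → All P (triples es cs)
  All-triples f _        []         = []
  All-triples f []       (_ ∷ _)    = []
  All-triples f (c ∷ cs) (ab ∷ abs) = f c ab ∷ All-triples f cs abs

-- Matchings of a symmetric relation

module Matching {A : Set} {_~_ : Rel A 0ℓ} (_~?_ : Binary.Decidable _~_) (~-sym : Symmetric _~_)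
                (U : List A) where

  degIn : A → List A → ℕ
  degIn u xs = length (filter (u ~?_) xs)

  deg : A → ℕ
  deg u = degIn u U

  degIn-++ : ∀ u xs ys → degIn u (xs ++ ys) ≡ degIn u xs + degIn u ys
  degIn-++ u xs ys = trans (cong length (filter-++ (u ~?_) xs ys)) (length-++ (filter (u ~?_) xs))

  degIn-↭ : ∀ u {xs ys} → xs ↭ ys → degIn u xs ≡ degIn u ys
  degIn-↭ u p = ↭-length (filter-↭ (u ~?_) p)

  degIn-none : ∀ {u xs} → All (λ x → ¬ u ~ x) xs → degIn u xs ≡ 0
  degIn-none {u} none = cong length (filter-none (u ~?_) none)

  degIn-∷-≤ : ∀ {u} x xs → ¬ Any (u ~_) xs → degIn u (x ∷ xs) ≤ 1
  degIn-∷-≤ {u} x xs none = begin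
    degIn u (x ∷ xs)                ≡⟨ degIn-++ u (x ∷ []) xs ⟩
    degIn u (x ∷ []) + degIn u xs   ≡⟨ cong (degIn u (x ∷ []) +_) (degIn-none (¬Any⇒All¬ xs none)) ⟩
    degIn u (x ∷ []) + 0            ≤⟨ +-monoˡ-≤ 0 (length-filter (u ~?_) (x ∷ [])) ⟩
    1                               ∎
    where open ≤-Reasoning

  degIn-pair-≤1 : ∀ {u a v b} → ¬ (u ~ a × v ~ b) → degIn u (a ∷ []) + degIn v (b ∷ []) ≤ 1
  degIn-pair-≤1 {u} {a} {v} {b} ¬both with u ~? a | v ~? b
  ... | yes u~a | yes v~b = ⊥-elim (¬both (u~a , v~b))
  ... | yes _   | no _    = ≤-refl
  ... | no _    | yes _   = ≤-refl
  ... | no _    | no _    = z≤n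

  -- The edge ab can be traded for ua and bv (an augmenting path u a b v).
  Augments : A → A → A × A → Set
  Augments u v (a , b) = u ~ a × v ~ b ⊎ u ~ b × v ~ a

  augments? : ∀ u v → Decidable (Augments u v)
  augments? u v (a , b) = (u ~? a ×-dec v ~? b) ⊎-dec (u ~? b ×-dec v ~? a)

  degIn-endpoints-≤ : ∀ {u v} es → All (¬_ ∘ Augments u v) es →
                      degIn u (endpoints es) + degIn v (endpoints es) ≤ length es + length es
  degIn-endpoints-≤         []             []              = z≤n
  degIn-endpoints-≤ {u} {v} ((a , b) ∷ es) (¬aug ∷ ¬augs) = begin
    degIn u (a ∷ b ∷ E) + degIn v (a ∷ b ∷ E)                    ≡⟨ cong₂ _+_ (split u) (split v) ⟩
    d u a + (d u b + degIn u E) + (d v a + (d v b + degIn v E))  ≡⟨ regroup (d u a) (d u b) (degIn u E)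
                                                                            (d v a) (d v b) (degIn v E) ⟩
    (d u a + d v b) + (d u b + d v a) + (degIn u E + degIn v E)  ≤⟨ +-mono-≤ (+-mono-≤ (degIn-pair-≤1 (¬aug ∘ inj₁))
                                                                                      (degIn-pair-≤1 (¬aug ∘ inj₂)))
                                                                            (degIn-endpoints-≤ es ¬augs) ⟩
    2 + (length es + length es)                                  ≡⟨ double-suc (length es) ⟩
    suc (length es) + suc (length es)                            ∎
    where
    open ≤-Reasoning
    E : List A
    E = endpoints es
    d : A → A → ℕ
    d x y = degIn x (y ∷ [])
    split : ∀ x → degIn x (a ∷ b ∷ E) ≡ d x a + (d x b + degIn x E)
    split x = trans (degIn-++ x (a ∷ []) (b ∷ E)) (cong (d x a +_) (degIn-++ x (b ∷ []) E))
    regroup : ∀ p q r s t w → p + (q + r) + (s + (t + w)) ≡ (p + t) + (q + s) + (r + w)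
    regroup = solve-∀
    double-suc : ∀ m → 2 + (m + m) ≡ suc m + suc m
    double-suc = solve-∀

  matched-partner : ∀ {x} es → All (uncurry _~_) es → x ∈ endpoints es →
    ∃₂ λ y es′ → x ~ y × All (uncurry _~_) es′ × endpoints es ↭ x ∷ y ∷ endpoints es′ ×
                 length es ≡ suc (length es′)
  matched-partner ((a , b) ∷ es) (a~b ∷ rel) (here refl)         = b , es , a~b , rel , ↭-refl , refl
  matched-partner ((a , b) ∷ es) (a~b ∷ rel) (there (here refl)) =
    a , es , ~-sym a~b , rel , ↭-swap a b ↭-refl , refl
  matched-partner ((a , b) ∷ es) (a~b ∷ rel) (there (there x∈))
    with y , es′ , x~y , rel′ , es↭ , len ← matched-partner es rel x∈ =
    y , (a , b) ∷ es′ , x~y , a~b ∷ rel′ ,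
    ↭-trans (++⁺ˡ (a ∷ b ∷ []) es↭) (shifts (a ∷ b ∷ []) (_ ∷ y ∷ [])) , cong suc len

  record PartialMatching (s : ℕ) : Set where
    field
      edges     : List (A × A)
      size      : length edges ≡ s
      related   : All (uncurry _~_) edges
      unmatched : List A
      covers    : endpoints edges ++ unmatched ↭ U

  open PartialMatching public

  empty : PartialMatching 0
  empty = record { edges = [] ; size = refl ; related = [] ; unmatched = U ; covers = ↭-refl }

  unmatched-length : ∀ {s} (M : PartialMatching s) → length (unmatched M) + (s + s) ≡ length U
  unmatched-length {s} M = begin
    length (unmatched M) + (s + s)                       ≡⟨ +-comm (length (unmatched M)) (s + s) ⟩
    s + s + length (unmatched M)                         ≡⟨ cong (_+ length (unmatched M)) matched-length ⟩
    length (endpoints (edges M)) + length (unmatched M)  ≡⟨ length-++ (endpoints (edges M)) ⟨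
    length (endpoints (edges M) ++ unmatched M)          ≡⟨ ↭-length (covers M) ⟩
    length U                                             ∎
    where
    open ≡-Reasoning
    matched-length : s + s ≡ length (endpoints (edges M))
    matched-length = trans (cong (λ k → k + k) (sym (size M))) (sym (length-endpoints (edges M)))

  isolated-deg-≤ : ∀ {a b es F} → endpoints ((a , b) ∷ es) ++ F ↭ U → ¬ Any (a ~_) (endpoints es) →
                   deg a ≤ 2 + length F
  isolated-deg-≤ {a} {b} {es} {F} covers isolated = begin
    deg a                                              ≡⟨ degIn-↭ a covers ⟨
    degIn a ((a ∷ b ∷ []) ++ endpoints es ++ F)        ≡⟨ degIn-++ a (a ∷ b ∷ []) (endpoints es ++ F) ⟩
    degIn a (a ∷ b ∷ []) + degIn a (endpoints es ++ F) ≡⟨ cong (degIn a (a ∷ b ∷ []) +_) (degIn-++ a (endpoints es) F) ⟩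
    degIn a (a ∷ b ∷ []) + (degIn a (endpoints es) + degIn a F)
                                                       ≡⟨ cong (λ k → degIn a (a ∷ b ∷ []) + (k + degIn a F))
                                                               (degIn-none (¬Any⇒All¬ _ isolated)) ⟩
    degIn a (a ∷ b ∷ []) + degIn a F                   ≤⟨ +-mono-≤ (length-filter (a ~?_) (a ∷ b ∷ []))
                                                                   (length-filter (a ~?_) F) ⟩
    2 + length F                                       ∎
    where open ≤-Reasoning

  extend : ∀ {j es u F w} → length es ≡ j → All (uncurry _~_) es → endpoints es ++ u ∷ F ↭ U →
           w ∈ F → u ~ w → PartialMatching (suc j)
  extend {es = es} {u} {F} {w} size related covers w∈F u~w with ∈-∃↭ w∈F
  ... | F′ , F↭ = record
    { edges = (u , w) ∷ es ; size = cong suc size ; related = u~w ∷ related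
    ; unmatched = F′ ; covers = covers′ }
    where
    open PermutationReasoning
    covers′ : u ∷ w ∷ endpoints es ++ F′ ↭ U
    covers′ = begin
      (u ∷ w ∷ []) ++ endpoints es ++ F′  ↭⟨ shifts (u ∷ w ∷ []) (endpoints es) ⟩
      endpoints es ++ u ∷ w ∷ F′          ↭⟨ ++⁺ˡ (endpoints es) (↭-prep u (↭-sym F↭)) ⟩
      endpoints es ++ u ∷ F               ↭⟨ covers ⟩
      U                                   ∎

  switch : ∀ {j es u v F a b} → length es ≡ j → All (uncurry _~_) es → endpoints es ++ u ∷ v ∷ F ↭ U →
           (a , b) ∈ es → u ~ a → v ~ b → PartialMatching (suc j)
  switch {es = es} {u} {v} {F} {a} {b} size related covers ab∈es u~a v~b with ∈-∃↭ ab∈es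
  ... | es′ , es↭ = record
    { edges = (u , a) ∷ (b , v) ∷ es′
    ; size = cong suc (trans (sym (↭-length es↭)) size)
    ; related = u~a ∷ ~-sym v~b ∷ All.tail (All-resp-↭ es↭ related)
    ; unmatched = F ; covers = covers′ }
    where
    open PermutationReasoning
    covers′ : u ∷ a ∷ b ∷ v ∷ endpoints es′ ++ F ↭ U
    covers′ = begin
      u ∷ ((a ∷ b ∷ []) ++ v ∷ endpoints es′ ++ F)  ↭⟨ ↭-prep u (shift v (a ∷ b ∷ []) _) ⟩
      (u ∷ v ∷ []) ++ (a ∷ b ∷ endpoints es′) ++ F  ↭⟨ shifts (u ∷ v ∷ []) (a ∷ b ∷ endpoints es′) ⟩
      endpoints ((a , b) ∷ es′) ++ u ∷ v ∷ F       ↭⟨ ++⁺ʳ (u ∷ v ∷ F) (endpoints-↭ es↭) ⟨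
      endpoints es ++ u ∷ v ∷ F                    ↭⟨ covers ⟩
      U                                            ∎

  -- Each edge contributes at most 2 to deg u + deg v, and u, v at most 1 each.
  blocked-pair-impossible : ∀ {j es u v F} → length es ≡ j → endpoints es ++ u ∷ v ∷ F ↭ U →
    (∀ x → suc j < deg x) → ¬ Any (u ~_) (v ∷ F) → ¬ Any (v ~_) (u ∷ F) → ¬ Any (Augments u v) es → ⊥
  blocked-pair-impossible {j} {es} {u} {v} {F} size covers δ> u-alone v-alone no-augmenting =
    <⇒≱ (+-mono-< (n<1+n j) (n<1+n j)) (begin
      suc j + suc j                ≤⟨ +-mono-≤ (deg-outside u (v ∷ F) u-alone ↭-refl)
                                               (deg-outside v (u ∷ F) v-alone (↭-swap u v ↭-refl)) ⟩
      degIn u E + degIn v E        ≤⟨ degIn-endpoints-≤ es (¬Any⇒All¬ es no-augmenting) ⟩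
      length es + length es        ≡⟨ cong (λ k → k + k) size ⟩
      j + j                        ∎)
    where
    open ≤-Reasoning
    E : List A
    E = endpoints es
    deg-outside : ∀ x rest → ¬ Any (x ~_) rest → u ∷ v ∷ F ↭ x ∷ rest → suc j ≤ degIn x E
    deg-outside x rest alone perm = s≤s⁻¹ (begin
      suc (suc j)                   ≤⟨ δ> x ⟩
      deg x                         ≡⟨ degIn-↭ x (↭-trans (++⁺ˡ E (↭-sym perm)) covers) ⟨
      degIn x (E ++ x ∷ rest)       ≡⟨ degIn-++ x E (x ∷ rest) ⟩
      degIn x E + degIn x (x ∷ rest) ≤⟨ +-monoʳ-≤ (degIn x E) (degIn-∷-≤ x rest alone) ⟩
      degIn x E + 1                 ≡⟨ +-comm (degIn x E) 1 ⟩
      suc (degIn x E)               ∎)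

  augment : ∀ {j} → (∀ x → suc j < deg x) → suc j + suc j ≤ length U →
            PartialMatching j → PartialMatching (suc j)
  augment {j} δ> room M with unmatched M | covers M | two-unmatched
    where
    two-unmatched : 2 ≤ length (unmatched M)
    two-unmatched = +-cancelʳ-≤ (j + j) 2 _ (begin
      2 + (j + j)                     ≡⟨ cong suc (sym (+-suc j j)) ⟩
      suc j + suc j                   ≤⟨ room ⟩
      length U                        ≡⟨ unmatched-length M ⟨
      length (unmatched M) + (j + j)  ∎)
      where open ≤-Reasoning
  ... | _ ∷ []    | _      | s≤s ()
  ... | u ∷ v ∷ F | covers | _
    with any? (u ~?_) (v ∷ F) | any? (v ~?_) (u ∷ F) | any? (augments? u v) (edges M)
  ... | yes u~ | _      | _ = let w , w∈ , u~w = find u~ in extend (size M) (related M) covers w∈ u~w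
  ... | no _   | yes v~ | _ = let w , w∈ , v~w = find v~ in
                              extend (size M) (related M) (↭-trans (++⁺ˡ _ (↭-swap v u ↭-refl)) covers) w∈ v~w
  ... | no _   | no _   | yes aug with find aug
  ...   | _ , ab∈ , inj₁ (u~a , v~b) = switch (size M) (related M) covers ab∈ u~a v~b
  ...   | _ , ab∈ , inj₂ (u~b , v~a) =
          switch (size M) (related M) (↭-trans (++⁺ˡ _ (↭-swap v u ↭-refl)) covers) ab∈ v~a u~b
  augment δ> room M | u ∷ v ∷ F | covers | _ | no u-alone | no v-alone | no no-augmenting =
    ⊥-elim (blocked-pair-impossible (size M) covers δ> u-alone v-alone no-augmenting)

  matching : ∀ s → (∀ x → s < deg x) → s + s ≤ length U → PartialMatching s
  matching zero    _  _    = empty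
  matching (suc s) δ> room = augment δ> room (matching s (λ x → ≤-trans (n≤1+n (suc s)) (δ> x))
                                                       (≤-trans (+-mono-≤ (n≤1+n s) (n≤1+n s)) room))

-- Forests in a graph

module _ {n : ℕ} (G : Graph n) where

  _≁_ : Fin n → Fin n → Set
  u ≁ v = ¬ T (adj G u v)

  _≁?_ : Binary.Decidable _≁_
  u ≁? v = ¬? (T? (adj G u v))

  adjacent : ∀ {u v} → adj G u v ≡ true → T (adj G u v)
  adjacent e = subst T (sym e) _

  adjacent-sym : ∀ {u v} → T (adj G u v) → T (adj G v u)
  adjacent-sym {u} {v} = subst T (adj-sym G u v)

  ≁-sym : Symmetric _≁_
  ≁-sym u≁v = u≁v ∘ adjacent-sym

  no-loop : ∀ {v} → ¬ T (adj G v v)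
  no-loop {v} = subst T (irrefl G v)

  cycle-neighbours : (C : Cycle G) (i : Fin (suc (suc (suc (len C))))) →
    ∃₂ λ j k → j ≢ k × T (adj G (vtx C i) (vtx C j)) × T (adj G (vtx C i) (vtx C k))
  cycle-neighbours C zero =
    suc zero , fromℕ _ , (λ ()) , adjacent (step C zero) , adjacent-sym (adjacent (close C))
  cycle-neighbours C (suc i) with view i
  ... | ‵fromℕ =
    inject₁ (fromℕ _) , zero , (λ ()) , adjacent-sym (adjacent (step C (fromℕ _))) , adjacent (close C)
  ... | ‵inj₁ {i = k} _ =
    inject₁ (inject₁ k) , suc (suc k) , inject₁²≢suc² k ,
    adjacent-sym (adjacent (step C (inject₁ k))) , adjacent (step C (suc k))
    where
    inject₁²≢suc² : ∀ {m} (k : Fin m) → inject₁ (inject₁ k) ≢ suc (suc k)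
    inject₁²≢suc² zero    ()
    inject₁²≢suc² (suc k) e = inject₁²≢suc² k (Fin.suc-injective e)

  forest-[] : InducesForest G (_∈ [])
  forest-[] (C , on) with on zero
  ... | ()

  forest-⊆ : ∀ {P Q : Fin n → Set} → (∀ {v} → P v → Q v) → InducesForest G Q → InducesForest G P
  forest-⊆ P⊆Q forest (C , on) = forest (C , P⊆Q ∘ on)

  -- A cycle through x would give x two distinct neighbours in B.
  forest-∷ : ∀ {x w B} → InducesForest G (_∈ B) → (∀ {y} → y ∈ B → T (adj G x y) → y ≡ w) →
             InducesForest G (_∈ x ∷ B)
  forest-∷ {x} {w} {B} forest neighbours (C , on) with Fin.any? (λ i → vtx C i ≟ x)
  ... | no x∉C = forest (C , λ i → in-B (on i) (λ e → x∉C (i , e)))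
    where
    in-B : ∀ {v} → v ∈ x ∷ B → v ≢ x → v ∈ B
    in-B (here v≡x) v≢x = ⊥-elim (v≢x v≡x)
    in-B (there v∈B) _  = v∈B
  ... | yes (i , refl) with cycle-neighbours C i
  ...   | j , k , j≢k , adj-j , adj-k = j≢k (inj C (trans (is-w j adj-j) (sym (is-w k adj-k))))
    where
    is-w : ∀ j → T (adj G (vtx C i) (vtx C j)) → vtx C j ≡ w
    is-w j a with on j
    ... | here e    = ⊥-elim (no-loop (subst (T ∘ adj G (vtx C i)) e a))
    ... | there y∈B = neighbours y∈B a

  forest-pair : ∀ x y → InducesForest G (_∈ x ∷ y ∷ [])
  forest-pair x y = forest-∷ (forest-∷ {w = y} forest-[] λ ()) λ { (here refl) _ → refl }

  forest-triple : ∀ {a b} c → a ≁ b → InducesForest G (_∈ a ∷ b ∷ c ∷ [])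
  forest-triple {a} {b} c a≁b = forest-∷ (forest-pair b c) λ where
    (here refl)         a~b → ⊥-elim (a≁b a~b)
    (there (here refl)) _   → refl

  -- Only ps, qs and qr can be edges, so G restricted to these vertices lies in the path r q s p.
  forest-path : ∀ {p q r s} → p ≁ q → p ≁ r → r ≁ s → InducesForest G (_∈ p ∷ r ∷ q ∷ s ∷ [])
  forest-path {p} {q} {r} {s} p≁q p≁r r≁s = forest-∷ {w = s} (forest-∷ {w = q} (forest-pair q s) λ where
      (here refl)         _   → refl
      (there (here refl)) r~s → ⊥-elim (r≁s r~s))
    λ where
      (here refl)                 p~r → ⊥-elim (p≁r p~r)
      (there (here refl))         p~q → ⊥-elim (p≁q p~q)
      (there (there (here refl))) _   → refl

  partition⇒coloring : ∀ {m q} (bs : List (List (Fin n))) → length bs ≡ suc m →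
    concat bs ↭ allFin n →
    All (λ B → InducesForest G (_∈ B)) bs →
    All (λ B → length B ≡ q ⊎ length B ≡ suc q) bs →
    EquitableTreeColoring G (suc m)
  partition⇒coloring bs@(_ ∷ _) refl covers forests sizes = colour , λ i → class-size i , class-forest i
    where
    member : ∀ v → Any (v ∈_) bs
    member v = ∈-concat⁻ bs (∈-resp-↭ (↭-sym covers) (∈-allFin v))
    colour : Fin n → Fin (length bs)
    colour v = Any.index (member v)
    in-own-block : ∀ v → v ∈ lookup bs (colour v)
    in-own-block v = lookup-index (member v)
    colour-of-block : ∀ {v} i → v ∈ lookup bs i → colour v ≡ i
    colour-of-block i = lookup-concat-unique bs (Unique-resp-↭ (↭-sym covers) (allFin⁺ n)) (in-own-block _)
    class-is-block : ∀ i → classSize colour i ≡ length (lookup bs i)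
    class-is-block i = begin
      length (filter in-class (allFin n))   ≡⟨ ↭-length (filter-↭ in-class (↭-sym covers)) ⟩
      length (filter in-class (concat bs))  ≡⟨ cong length (filter-concat≡lookup in-class bs i same-class) ⟩
      length (lookup bs i)                  ∎
      where
      open ≡-Reasoning
      in-class : Decidable (λ v → colour v ≡ i)
      in-class v = colour v ≟ i
      same-class : ∀ j {v} → v ∈ lookup bs j → colour v ≡ i ⇔ j ≡ i
      same-class j v∈ = mk⇔ (trans (sym (colour-of-block j v∈))) (trans (colour-of-block j v∈))
    EquitableSize : ℕ → Set
    EquitableSize s = s ≡ n / length bs ⊎ s ≡ ceilDiv n (length bs)
    equitable : All (EquitableSize ∘ length) bs
    equitable = subst (λ k → All (λ B → length B ≡ k / length bs ⊎ length B ≡ ceilDiv k (length bs)) bs)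
                      (trans (↭-length covers) (length-allFin n)) (balanced⇒equitable bs sizes)
    class-size : ∀ i → EquitableSize (classSize colour i)
    class-size i = subst EquitableSize (sym (class-is-block i)) (All.lookup equitable (∈-lookup i))
    class-forest : ∀ i → InducesForest G (λ v → colour v ≡ i)
    class-forest i = forest-⊆ {Q = _∈ lookup bs i} in-block (All.lookup forests (∈-lookup i))
      where
      in-block : ∀ {v} → colour v ≡ i → v ∈ lookup bs i
      in-block {v} refl = in-own-block v

  -- Non-adjacency is reflexive, so co-degree u counts u itself and complements degree G u exactly.
  open Matching _≁?_ ≁-sym (allFin n) renaming (deg to co-degree)

  degree+co-degree : ∀ u → degree G u + co-degree u ≡ n
  degree+co-degree u = trans (length-filter-∁ (T? ∘ adj G u) (allFin n)) (length-allFin n)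

  co-degree-> : ∀ {d s} → maxDegree G ≤ d → d + suc s ≡ n → ∀ u → s < co-degree u
  co-degree-> {d} {s} Δ≤d room u = +-cancelˡ-≤ d (suc s) (co-degree u) (begin
    d + suc s                 ≡⟨ room ⟩
    n                         ≡⟨ degree+co-degree u ⟨
    degree G u + co-degree u  ≤⟨ +-monoˡ-≤ (co-degree u) (≤-trans (≤-foldr-⊔ (degree G) (∈-allFin u)) Δ≤d) ⟩
    d + co-degree u           ∎)
    where open ≤-Reasoning

  large-matching : ∀ {d} s t → maxDegree G ≤ d → d + suc s ≡ n → t + (s + s) ≡ n →
                   Σ (PartialMatching s) λ M → length (unmatched M) ≡ t
  large-matching s t Δ≤d room count = M , +-cancelʳ-≡ (s + s) _ t (begin
      length (unmatched M) + (s + s)  ≡⟨ unmatched-length M ⟩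
      length (allFin n)               ≡⟨ length-allFin n ⟩
      n                               ≡⟨ count ⟨
      t + (s + s)                     ∎)
    where
    open ≡-Reasoning
    M : PartialMatching s
    M = matching s (co-degree-> Δ≤d room)
                   (≤-trans (m≤n+m (s + s) t) (≤-reflexive (trans count (sym (length-allFin n)))))

  triples-coloring : ∀ {m} (M : PartialMatching (suc m)) → length (unmatched M) ≡ suc m →
                     EquitableTreeColoring G (suc m)
  triples-coloring M F-length =
    partition⇒coloring {q = 2} (triples (edges M) F) (trans (length-triples (edges M) F es≡F) (size M))
      (↭-trans (concat-triples (edges M) F es≡F) (covers M))
      (All-triples forest-triple F (related M))
      (All.map inj₂ (triples-length (edges M) F))
    where
    F : List (Fin n)
    F = unmatched M
    es≡F : length (edges M) ≡ length F
    es≡F = trans (size M) (sym F-length)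

  pair-and-triples-coloring : ∀ {m} (M : PartialMatching m) → length (unmatched M) ≡ suc (suc m) →
                              EquitableTreeColoring G (suc m)
  pair-and-triples-coloring M F-length with unmatched M | covers M | F-length
  ... | f₁ ∷ f₂ ∷ F | covers | F-length′ =
    partition⇒coloring {q = 2} ((f₁ ∷ f₂ ∷ []) ∷ triples (edges M) F)
      (cong suc (trans (length-triples (edges M) F es≡F) (size M))) covers′
      (forest-pair f₁ f₂ ∷ All-triples forest-triple F (related M))
      (inj₁ refl ∷ All.map inj₂ (triples-length (edges M) F))
    where
    es≡F : length (edges M) ≡ length F
    es≡F = trans (size M) (sym (suc-injective (suc-injective F-length′)))
    covers′ : f₁ ∷ f₂ ∷ concat (triples (edges M) F) ↭ allFin n
    covers′ = ↭-trans (++⁺ˡ (f₁ ∷ f₂ ∷ []) (concat-triples (edges M) F es≡F))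
                      (↭-trans (shifts (f₁ ∷ f₂ ∷ []) (endpoints (edges M))) covers)

  quad-and-triples-coloring : ∀ {m} (M : PartialMatching (suc (suc m))) → length (unmatched M) ≡ m →
                              (∀ u → suc (suc m) < co-degree u) → EquitableTreeColoring G (suc m)
  quad-and-triples-coloring {m} M F-length co-degree> with edges M | size M | related M | covers M
  ... | (a , b) ∷ es | es-length | a≁b ∷ related | covers with any? (a ≁?_) (endpoints es)
  ...   | no a-isolated =
    ⊥-elim (<⇒≱ (co-degree> a) (≤-trans (isolated-deg-≤ covers a-isolated) (≤-reflexive (cong (2 +_) F-length))))
  ...   | yes a≁some with find a≁some
  ...     | x , x∈ , a≁x with matched-partner es related x∈
  ...       | y , es′ , x≁y , related′ , es↭ , es′-length =
    partition⇒coloring {q = 3} ((a ∷ x ∷ b ∷ y ∷ []) ∷ triples es′ F)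
      (cong suc (trans (length-triples es′ F es′≡F) es′≡m)) covers′
      (forest-path a≁b a≁x x≁y ∷ All-triples forest-triple F related′)
      (inj₂ refl ∷ All.map inj₁ (triples-length es′ F))
    where
    F : List (Fin n)
    F = unmatched M
    es′≡m : length es′ ≡ m
    es′≡m = suc-injective (trans (sym es′-length) (suc-injective es-length))
    es′≡F : length es′ ≡ length F
    es′≡F = trans es′≡m (sym F-length)
    open PermutationReasoning
    covers′ : a ∷ x ∷ b ∷ y ∷ concat (triples es′ F) ↭ allFin n
    covers′ = begin
      a ∷ x ∷ b ∷ y ∷ concat (triples es′ F)  ↭⟨ ++⁺ˡ (a ∷ x ∷ b ∷ y ∷ []) (concat-triples es′ F es′≡F) ⟩
      a ∷ x ∷ b ∷ y ∷ endpoints es′ ++ F      ↭⟨ ↭-prep a (↭-swap x b ↭-refl) ⟩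
      a ∷ b ∷ x ∷ y ∷ endpoints es′ ++ F      ↭⟨ ++⁺ˡ (a ∷ b ∷ []) (++⁺ʳ F (↭-sym es↭)) ⟩
      a ∷ b ∷ endpoints es ++ F               ↭⟨ covers ⟩
      allFin n                                ∎

  -- With k = m + 1 colours and Δ ≤ 2k − 1, the matching has size n − 2k.
  equitable-tree-coloring : ∀ m → maxDegree G ≤ suc (m + m) → 3 * m + 2 ≤ n → n ≤ 3 * m + 4 →
                            EquitableTreeColoring G (suc m)
  equitable-tree-coloring m Δ≤ lower upper =
    [ by-pair , [ by-triples , by-quad ]′ ]′ (≤-≤-2+-cases lower (subst (n ≤_) (two-more m) upper))
    where
    two-more : ∀ m → 3 * m + 4 ≡ 2 + (3 * m + 2)
    two-more = solve-∀
    room₀ : ∀ m → suc (m + m) + suc m ≡ 3 * m + 2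
    room₀ = solve-∀
    count₀ : ∀ m → suc (suc m) + (m + m) ≡ 3 * m + 2
    count₀ = solve-∀
    room₁ : ∀ m → suc (m + m) + suc (suc m) ≡ suc (3 * m + 2)
    room₁ = solve-∀
    count₁ : ∀ m → suc m + (suc m + suc m) ≡ suc (3 * m + 2)
    count₁ = solve-∀
    room₂ : ∀ m → suc (m + m) + suc (suc (suc m)) ≡ suc (suc (3 * m + 2))
    room₂ = solve-∀
    count₂ : ∀ m → m + (suc (suc m) + suc (suc m)) ≡ suc (suc (3 * m + 2))
    count₂ = solve-∀
    by-pair : n ≡ 3 * m + 2 → EquitableTreeColoring G (suc m)
    by-pair n≡ = uncurry pair-and-triples-coloring
      (large-matching m (suc (suc m)) Δ≤ (trans (room₀ m) (sym n≡)) (trans (count₀ m) (sym n≡)))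
    by-triples : n ≡ suc (3 * m + 2) → EquitableTreeColoring G (suc m)
    by-triples n≡ = uncurry triples-coloring
      (large-matching (suc m) (suc m) Δ≤ (trans (room₁ m) (sym n≡)) (trans (count₁ m) (sym n≡)))
    by-quad : n ≡ suc (suc (3 * m + 2)) → EquitableTreeColoring G (suc m)
    by-quad n≡ = uncurry (λ M F-length → quad-and-triples-coloring M F-length
                                           (co-degree-> Δ≤ (trans (room₂ m) (sym n≡))))
      (large-matching (suc (suc m)) m Δ≤ (trans (room₂ m) (sym n≡)) (trans (count₂ m) (sym n≡)))

-- ⌈ Δ + 1 /2⌉ is suc ⌊ Δ /2⌋ by computation once Δ + 1 is written as suc Δ.
theorem2p5 : ∀ {n : ℕ} (G : Graph n) →
    3 * maxDegree G + 3 < 2 * n →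
    2 * n ≤ 3 * maxDegree G + 6 →
    AeqAtMost G ⌈ maxDegree G + 1 /2⌉
theorem2p5 G lower upper =
  ⌊ maxDegree G /2⌋ , ≤-reflexive (cong ⌈_/2⌉ (+-comm 1 (maxDegree G))) ,
  uncurry (equitable-tree-coloring G ⌊ maxDegree G /2⌋ (proj₂ (half-bounds (maxDegree G))))
          (order-bounds {maxDegree G} lower upper)
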